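{- Let $\mathcal C\subseteq\mathbb{F}_q^n$ be a $q$-ary code of length $n$ with $M=|\mathcal C|$ codewords, and let $r$ be the remainder of $M$ upon division by $q$. Define $S(k)$ as in the context. Then for each $k=1,2,\dots,n$, $$S(k)\le (q-1)^k\binom{n}{k}\left[\frac{q-1}{2q}M^2+\frac{r(r-q)}{2q}\right].$$
   Context: $\mathbb{F}_q$ is a finite field with $q$ elements, $\mathbb{F}_q^*=\mathbb{F}_q\setminus\{0\}$, and its elements are enumerated as $\mathbb{F}_q=\{0=\omega_1,\omega_2,\dots,\omega_q\}$. A $q$-ary code of length $n$ is a subset of $\mathbb{F}_q^n$. The code $\mathcal C$ is regarded as an $M\times n$ matrix whose rows are the codewords (in some fixed order); its columns are $u'_1,\dots,u'_n\in\mathbb{F}_q^M$. For $a=(a_1,\dots,a_M)\in\mathbb{F}_q^M$ and $c\in\{1,\dots,q\}$, let $x_c(a)=|\{j : a_j=\omega_c\}|$. For $k=1,\dots,n$, $$S(k)=\sum_{\alpha=(\alpha_1,\dots,\alpha_k)\in(\mathbb{F}_q^*)^k}\ \sum_{1\le i_1<\cdots<i_k\le n}\ \sum_{1\le c<d\le q} x_c(\alpha_1u'_{i_1}+\cdots+\alpha_ku'_{i_k})\, x_d(\alpha_1u'_{i_1}+\cdots+\alpha_ku'_{i_k}).$$ -}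

module Defs where

open import Level using (Level; _⊔_)
open import Algebra.Bundles using (CommutativeRing)
open import Data.Nat as Nat using (ℕ; zero; suc; NonZero; _∸_; _^_; _%_)
open import Data.Nat.Properties as Nat using (m*n≢0)
open import Data.Nat.Combinatorics using (_C_)
open import Data.Fin as Fin using (Fin; toℕ)
open import Data.Fin.Properties using (all?) renaming (_<?_ to _<ᶠ?_)
open import Data.Integer as ℤ using (ℤ; +_)
open import Data.Rational as ℚ using (ℚ)
open import Data.List using (List; []; _∷_; map; concatMap; filter; length; allFin; cartesianProduct)
open import Data.Nat.ListAction using (sum)
open import Data.Product using (_×_; _,_; ∃; proj₁; proj₂)
open import Data.Vec.Functional using (Vector) renaming (_∷_ to _∷ᵛ_)
open import Relation.Nullary using (¬_; Dec; ¬?)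
open import Relation.Nullary.Decidable using (_→-dec_)
open import Relation.Binary using (Decidable)
open import Relation.Binary.PropositionalEquality using (_≡_)

-- Equality is decidable, and ω : Fin q → Carrier is a bijection (up to
-- _≈_) whose first element (index 0, i.e. ω₁ in the paper) is 0.

record IsFiniteField {c ℓ} (F : CommutativeRing c ℓ) (q : ℕ) : Set (c ⊔ ℓ) where
  open CommutativeRing F
  field
    0≉1      : ¬ (0# ≈ 1#)
    inverse  : ∀ x → ¬ (x ≈ 0#) → ∃ λ y → x * y ≈ 1#
    _≈?_     : Decidable _≈_
    ω        : Fin q → Carrier
    ω-inj    : ∀ i j → ω i ≈ ω j → i ≡ j
    ω-surj   : ∀ x → ∃ λ i → ω i ≈ x
    ω₁≈0     : ∀ i → toℕ i ≡ 0 → ω i ≈ 0#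

allFuns : (k m : ℕ) → List (Fin k → Fin m)
allFuns zero    m = (λ ()) ∷ []
allFuns (suc k) m = concatMap (λ a → map (λ f → a ∷ᵛ f) (allFuns k m)) (allFin m)

increasing? : ∀ {k n} (I : Fin k → Fin n) → Dec (∀ s t → s Fin.< t → I s Fin.< I t)
increasing? I = all? λ s → all? λ t → (s <ᶠ? t) →-dec (I s <ᶠ? I t)

incTuples : (k n : ℕ) → List (Fin k → Fin n)
incTuples k n = filter increasing? (allFuns k n)

ltPairs : (q : ℕ) → List (Fin q × Fin q)
ltPairs q = filter (λ p → proj₁ p <ᶠ? proj₂ p) (cartesianProduct (allFin q) (allFin q))

-- The quantity S(k) for a code C given as an M × n matrix over F
-- (rows = codewords, C j i = i-th coordinate of the j-th codeword).

module Code {c ℓ} (F : CommutativeRing c ℓ) {q : ℕ} (FF : IsFiniteField F q) where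
  open CommutativeRing F
  open IsFiniteField FF

  Σᶠ : ∀ {k} → (Fin k → Carrier) → Carrier
  Σᶠ {zero}  f = 0#
  Σᶠ {suc k} f = f Fin.zero + Σᶠ (λ t → f (Fin.suc t))

  nonzeroTuples : (k : ℕ) → List (Fin k → Carrier)
  nonzeroTuples k =
    filter (λ α → all? (λ t → ¬? (α t ≈? 0#))) (map (λ f t → ω (f t)) (allFuns k q))

  x : ∀ {M} → Fin q → (Fin M → Carrier) → ℕ
  x {M} cc a = length (filter (λ j → a j ≈? ω cc) (allFin M))

  column : ∀ {M n} → (Fin M → Fin n → Carrier) → Fin n → (Fin M → Carrier)
  column code i j = code j i

  combo : ∀ {M n k} → (Fin M → Fin n → Carrier) → (Fin k → Carrier) → (Fin k → Fin n)
        → (Fin M → Carrier)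
  combo code α I j = Σᶠ (λ t → α t * column code (I t) j)

  S : ∀ {M n} → (Fin M → Fin n → Carrier) → ℕ → ℕ
  S {M} {n} code k =
    sum (map (λ α →
      sum (map (λ I →
        sum (map (λ p → x (proj₁ p) (combo code α I) Nat.* x (proj₂ p) (combo code α I))
                 (ltPairs q)))
          (incTuples k n)))
      (nonzeroTuples k))

  -- q ≠ 0 (F has the element 0, so Fin q is inhabited)
  q-nonZero : NonZero q
  q-nonZero = fromFin (proj₁ (ω-surj 0#))
    where
    fromFin : ∀ {m} → Fin m → NonZero m
    fromFin {suc _} _ = _

  2q-nonZero : NonZero (2 Nat.* q)
  2q-nonZero = Nat.m*n≢0 2 q {{_}} {{q-nonZero}}

  bound : (M n k : ℕ) → ℚ
  bound M n k =
    (+ ((q ∸ 1) ^ k Nat.* (n C k)) ℚ./ 1)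
      ℚ.* ( ((+ ((q ∸ 1) Nat.* (M Nat.* M))) ℚ./ (2 Nat.* q)) {{2q-nonZero}}
          ℚ.+ ((+ r ℤ.* (+ r ℤ.- + q)) ℚ./ (2 Nat.* q)) {{2q-nonZero}} )
    where
    r : ℕ
    r = (M % q) {{q-nonZero}}

-- For a fixed v ∈ F^M the counts x_c(v) of the q field elements sum to M, so
-- 2 Σ_{c<d} x_c x_d = M² − Σ_c x_c².  Writing M = mq + r, the inequality
-- (2m+1)x ≤ x² + m(m+1), i.e. (x − m)(x − m − 1) ≥ 0, summed over c yields
-- q Σ_c x_c² ≥ M² + r(q − r), the value at the balanced distribution.  Hence every
-- inner sum of S(k) is at most ((q−1)M² − r(q−r))/(2q), and there are at most
-- (q−1)^k tuples α and C(n,k) index sets i₁ < ⋯ < i_k.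

module Submission where

open import Defs
open import Algebra.Bundles using (CommutativeRing)
open import Data.Bool using (T; true; false; if_then_else_)
open import Data.Empty using (⊥-elim)
open import Data.Fin as Fin using (Fin; zero; suc; toℕ)
open import Data.Fin.Properties using (0≢1+n; suc-injective; all?) renaming (_<?_ to _<ᶠ?_)
open import Data.Integer as ℤ using (ℤ)
import Data.Integer.Properties as ℤ
open import Data.Integer.Tactic.RingSolver as ℤ-Solver using ()
open import Data.List using (List; []; _∷_; _++_; map; concatMap; filter; length; allFin; cartesianProduct)
open import Data.List.Properties using (map-cong; map-tabulate; map-++; map-∘; filter-++; filter-none; length-++; length-tabulate; length-filter)
open import Data.List.Relation.Unary.All using (universal)
open import Data.Nat as ℕ using (ℕ; zero; suc; _+_; _*_; _∸_; _^_; _≤_; _<ᵇ_; z≤n; s≤s)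
open import Data.Nat.Combinatorics using (_C_; nCk+nC[k+1]≡[n+1]C[k+1])
open import Data.Nat.DivMod using (_%_; _/_; m≡m%n+[m/n]*n; m%n<n)
open import Data.Nat.ListAction using (sum)
open import Data.Nat.ListAction.Properties using (sum-++)
import Data.Nat.Properties as ℕ
open import Algebra.Properties.CommutativeSemigroup ℕ.+-commutativeSemigroup using () renaming (interchange to +-interchange)
open import Data.Nat.Tactic.RingSolver using (solve-∀)
open import Data.Product using (_×_; _,_; proj₁; proj₂)
import Data.Rational as ℚ
import Data.Rational.Properties as ℚ
import Data.Rational.Unnormalised as ℚᵘ
import Data.Rational.Unnormalised.Properties as ℚᵘ
open import Data.Vec.Functional using () renaming (_∷_ to _∷ᵛ_)
open import Function using (_∘_)
open import Relation.Binary.PropositionalEquality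
open import Relation.Nullary using (yes; no; does; ¬_; ¬?)
open import Relation.Nullary.Decidable using (_×-dec_)
open import Relation.Unary using (Pred; Decidable)

module _ {a} {A : Set a} where

  sum-map-mono : ∀ {f g : A → ℕ} → (∀ x → f x ≤ g x) → ∀ xs → sum (map f xs) ≤ sum (map g xs)
  sum-map-mono f≤g []       = z≤n
  sum-map-mono f≤g (x ∷ xs) = ℕ.+-mono-≤ (f≤g x) (sum-map-mono f≤g xs)

  sum-map-+ : ∀ (f g : A → ℕ) xs → sum (map (λ x → f x + g x) xs) ≡ sum (map f xs) + sum (map g xs)
  sum-map-+ f g []       = refl
  sum-map-+ f g (x ∷ xs) = trans (cong ((f x + g x) +_) (sum-map-+ f g xs)) (+-interchange (f x) (g x) _ _)

  sum-map-*ˡ : ∀ m (f : A → ℕ) xs → sum (map (λ x → m * f x) xs) ≡ m * sum (map f xs)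
  sum-map-*ˡ m f []       = sym (ℕ.*-zeroʳ m)
  sum-map-*ˡ m f (x ∷ xs) = trans (cong (m * f x +_) (sum-map-*ˡ m f xs)) (sym (ℕ.*-distribˡ-+ m (f x) _))

  sum-map-const : ∀ c (xs : List A) → sum (map (λ _ → c) xs) ≡ length xs * c
  sum-map-const c []       = refl
  sum-map-const c (x ∷ xs) = cong (c +_) (sum-map-const c xs)

  sum-map-≤ : ∀ {f : A → ℕ} c → (∀ x → f x ≤ c) → ∀ xs → sum (map f xs) ≤ length xs * c
  sum-map-≤ c f≤c xs = ℕ.≤-trans (sum-map-mono f≤c xs) (ℕ.≤-reflexive (sum-map-const c xs))

  *-sum-map-≤ : ∀ m c (f : A → ℕ) → (∀ x → m * f x ≤ c) → ∀ xs → m * sum (map f xs) ≤ length xs * c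
  *-sum-map-≤ m c f bound xs = subst (_≤ length xs * c) (sum-map-*ˡ m f xs) (sum-map-≤ c bound xs)

  module _ {p} {P : Pred A p} (P? : Decidable P) where

    sum-map-filter : ∀ (f : A → ℕ) xs →
      sum (map f (filter P? xs)) ≡ sum (map (λ x → if does (P? x) then f x else 0) xs)
    sum-map-filter f []       = refl
    sum-map-filter f (x ∷ xs) with does (P? x)
    ... | true  = cong (f x +_) (sum-map-filter f xs)
    ... | false = sum-map-filter f xs

    length-filter≡sum : ∀ xs → length (filter P? xs) ≡ sum (map (λ x → if does (P? x) then 1 else 0) xs)
    length-filter≡sum []       = refl
    length-filter≡sum (x ∷ xs) with does (P? x)
    ... | true  = cong suc (length-filter≡sum xs)
    ... | false = length-filter≡sum xs

    length-filter-mono : ∀ {q} {Q : Pred A q} (Q? : Decidable Q) → (∀ {x} → P x → Q x) →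
      ∀ xs → length (filter P? xs) ≤ length (filter Q? xs)
    length-filter-mono Q? P⇒Q []       = z≤n
    length-filter-mono Q? P⇒Q (x ∷ xs) with P? x | Q? x
    ... | yes _  | yes _  = s≤s (length-filter-mono Q? P⇒Q xs)
    ... | yes px | no ¬qx = ⊥-elim (¬qx (P⇒Q px))
    ... | no _   | yes _  = ℕ.m≤n⇒m≤1+n (length-filter-mono Q? P⇒Q xs)
    ... | no _   | no _   = length-filter-mono Q? P⇒Q xs

    length-filter-empty : (∀ x → ¬ P x) → ∀ xs → length (filter P? xs) ≡ 0
    length-filter-empty ∅ xs = cong length (filter-none P? (universal ∅ xs))

    length-filter-concatMap : ∀ {b} {B : Set b} (g : B → List A) bs →
      length (filter P? (concatMap g bs)) ≡ sum (map (λ y → length (filter P? (g y))) bs)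
    length-filter-concatMap g []       = refl
    length-filter-concatMap g (y ∷ bs) = begin
      length (filter P? (g y ++ concatMap g bs))              ≡⟨ cong length (filter-++ P? (g y) _) ⟩
      length (filter P? (g y) ++ filter P? (concatMap g bs))  ≡⟨ length-++ (filter P? (g y)) ⟩
      length (filter P? (g y)) + length (filter P? (concatMap g bs)) ≡⟨ cong (_ +_) (length-filter-concatMap g bs) ⟩
      length (filter P? (g y)) + sum (map (λ y → length (filter P? (g y))) bs) ∎
      where open ≡-Reasoning

  length-filter-map : ∀ {b p} {B : Set b} {P : Pred B p} (P? : Decidable P) (f : A → B) xs →
    length (filter P? (map f xs)) ≡ length (filter (P? ∘ f) xs)
  length-filter-map P? f []       = refl
  length-filter-map P? f (x ∷ xs) with does (P? (f x))
  ... | true  = cong suc (length-filter-map P? f xs)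
  ... | false = length-filter-map P? f xs

sum-map-swap : ∀ {a b} {A : Set a} {B : Set b} (h : A → B → ℕ) xs ys →
  sum (map (λ x → sum (map (h x) ys)) xs) ≡ sum (map (λ y → sum (map (λ x → h x y) xs)) ys)
sum-map-swap h []       ys = sym (trans (sum-map-const 0 ys) (ℕ.*-zeroʳ (length ys)))
sum-map-swap h (x ∷ xs) ys = begin
  sum (map (h x) ys) + sum (map (λ x → sum (map (h x) ys)) xs)          ≡⟨ cong (_ +_) (sum-map-swap h xs ys) ⟩
  sum (map (h x) ys) + sum (map (λ y → sum (map (λ x → h x y) xs)) ys)  ≡⟨ sum-map-+ (h x) _ ys ⟨
  sum (map (λ y → h x y + sum (map (λ x → h x y) xs)) ys)              ∎
  where open ≡-Reasoning

sum-map-cartesianProduct : ∀ {a b} {A : Set a} {B : Set b} (h : A × B → ℕ) xs ys →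
  sum (map h (cartesianProduct xs ys)) ≡ sum (map (λ x → sum (map (λ y → h (x , y)) ys)) xs)
sum-map-cartesianProduct h []       ys = refl
sum-map-cartesianProduct h (x ∷ xs) ys = begin
  sum (map h (map (x ,_) ys ++ cartesianProduct xs ys))              ≡⟨ cong sum (map-++ h (map (x ,_) ys) _) ⟩
  sum (map h (map (x ,_) ys) ++ map h (cartesianProduct xs ys))       ≡⟨ sum-++ (map h (map (x ,_) ys)) _ ⟩
  sum (map h (map (x ,_) ys)) + sum (map h (cartesianProduct xs ys))  ≡⟨ cong₂ _+_ (cong sum (sym (map-∘ ys))) (sum-map-cartesianProduct h xs ys) ⟩
  sum (map (λ y → h (x , y)) ys) + sum (map (λ x → sum (map (λ y → h (x , y)) ys)) xs) ∎
  where open ≡-Reasoning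

∑ : ∀ {n} → (Fin n → ℕ) → ℕ
∑ {n} f = sum (map f (allFin n))

∑-suc : ∀ {n} (f : Fin (suc n) → ℕ) → ∑ f ≡ f zero + ∑ (f ∘ suc)
∑-suc f = cong (λ xs → f zero + sum xs) (trans (map-tabulate suc f) (sym (map-tabulate (λ i → i) (f ∘ suc))))

∑-const : ∀ n c → ∑ {n} (λ _ → c) ≡ n * c
∑-const n c = trans (sum-map-const c (allFin n)) (cong (_* c) (length-tabulate {n = n} (λ i → i)))

∑-≤ : ∀ {n} {f : Fin n → ℕ} c → (∀ a → f a ≤ c) → ∑ f ≤ n * c
∑-≤ {n} c f≤c = ℕ.≤-trans (sum-map-mono f≤c (allFin n)) (ℕ.≤-reflexive (∑-const n c))

∑-indicator-unique : ∀ {n p} {P : Pred (Fin n) p} (P? : Decidable P) i → P i → (∀ c → P c → c ≡ i) →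
  ∑ (λ c → if does (P? c) then 1 else 0) ≡ 1
∑-indicator-unique {suc n} P? i Pi unique rewrite ∑-suc (λ c → if does (P? c) then 1 else 0) with P? zero | i
... | yes _   | zero  = cong suc (trans (sym (length-filter≡sum (P? ∘ suc) (allFin n)))
                          (length-filter-empty (P? ∘ suc) (λ c Pc → 0≢1+n (sym (unique (suc c) Pc))) (allFin n)))
... | yes P0  | suc _ = ⊥-elim (0≢1+n (unique zero P0))
... | no ¬P0  | zero  = ⊥-elim (¬P0 Pi)
... | no _    | suc i = ∑-indicator-unique (P? ∘ suc) i Pi (λ c Pc → suc-injective (unique (suc c) Pc))

length-filter-allFuns-suc : ∀ {k m p} {P : Pred (Fin (suc k) → Fin m) p} (P? : Decidable P) →
  length (filter P? (allFuns (suc k) m)) ≡ ∑ (λ a → length (filter (P? ∘ (a ∷ᵛ_)) (allFuns k m)))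
length-filter-allFuns-suc {k} {m} P? =
  trans (length-filter-concatMap P? (λ a → map (a ∷ᵛ_) (allFuns k m)) (allFin m))
        (cong sum (map-cong (λ a → length-filter-map P? (a ∷ᵛ_) (allFuns k m)) (allFin m)))

module _ {m p} {Z : Pred (Fin (suc m)) p} (Z? : Decidable Z) where

  avoids? : ∀ {k} → Decidable (λ (f : Fin k → Fin (suc m)) → ∀ t → ¬ Z (f t))
  avoids? f = all? (λ t → ¬? (Z? (f t)))

  length-avoiding-≤ : Z zero → ∀ k → length (filter avoids? (allFuns k (suc m))) ≤ m ^ k
  length-avoiding-≤ Z0 zero    = length-filter avoids? (allFuns 0 (suc m))
  length-avoiding-≤ Z0 (suc k) = begin
    length (filter avoids? (allFuns (suc k) (suc m))) ≡⟨ length-filter-allFuns-suc {k} avoids? ⟩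
    ∑ avoiding-with                                    ≡⟨ ∑-suc avoiding-with ⟩
    avoiding-with zero + ∑ (avoiding-with ∘ suc)       ≡⟨ cong (_+ ∑ (avoiding-with ∘ suc)) starting-at-zero ⟩
    ∑ (avoiding-with ∘ suc)                            ≤⟨ ∑-≤ (m ^ k) (λ a → ℕ.≤-trans (starting-at (suc a)) (length-avoiding-≤ Z0 k)) ⟩
    m * m ^ k                                          ∎
    where
    open ℕ.≤-Reasoning
    avoiding-with : Fin (suc m) → ℕ
    avoiding-with a = length (filter (avoids? ∘ (a ∷ᵛ_)) (allFuns k (suc m)))
    starting-at-zero : avoiding-with zero ≡ 0
    starting-at-zero = length-filter-empty (avoids? ∘ (zero ∷ᵛ_)) (λ f avoids → avoids zero Z0) (allFuns k (suc m))
    starting-at : ∀ a → avoiding-with a ≤ length (filter avoids? (allFuns k (suc m)))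
    starting-at a = length-filter-mono (avoids? ∘ (a ∷ᵛ_)) avoids? (λ avoids t → avoids (suc t)) (allFuns k (suc m))

-- The test is phrased with _<ᵇ_ so that it computes when both arguments are successors.
hockey-stick : ∀ n m k → ∑ {n} (λ a → if toℕ a <ᵇ m then 0 else (n ∸ suc (toℕ a)) C k) ≡ (n ∸ m) C suc k
hockey-stick zero    zero    k = refl
hockey-stick zero    (suc m) k = refl
hockey-stick (suc n) zero    k = begin
  ∑ {suc n} (λ a → (suc n ∸ suc (toℕ a)) C k) ≡⟨ ∑-suc {n} (λ a → (suc n ∸ suc (toℕ a)) C k) ⟩
  n C k + ∑ {n} (λ a → (n ∸ suc (toℕ a)) C k)  ≡⟨ cong (n C k +_) (hockey-stick n zero k) ⟩
  n C k + n C suc k                            ≡⟨ nCk+nC[k+1]≡[n+1]C[k+1] n k ⟩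
  suc n C suc k                                ∎
  where open ≡-Reasoning
hockey-stick (suc n) (suc m) k = trans (∑-suc {n} (λ a → if toℕ a <ᵇ suc m then 0 else (suc n ∸ suc (toℕ a)) C k)) (hockey-stick n m k)

IncreasingFrom : ∀ {k n} → ℕ → (Fin k → Fin n) → Set
IncreasingFrom m I = (∀ s t → s Fin.< t → I s Fin.< I t) × (∀ t → m ≤ toℕ (I t))

increasingFrom? : ∀ {k n} m → Decidable (IncreasingFrom {k} {n} m)
increasingFrom? m I = increasing? I ×-dec all? (λ t → m ℕ.≤? toℕ (I t))

length-increasingFrom-≤ : ∀ k n m → length (filter (increasingFrom? m) (allFuns k n)) ≤ (n ∸ m) C k
length-increasingFrom-≤ zero    n m = length-filter (increasingFrom? m) (allFuns 0 n)
length-increasingFrom-≤ (suc k) n m = begin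
  length (filter (increasingFrom? m) (allFuns (suc k) n))                ≡⟨ length-filter-allFuns-suc {k} {n} (increasingFrom? m) ⟩
  ∑ (λ a → length (filter (increasingFrom? m ∘ (a ∷ᵛ_)) (allFuns k n))) ≤⟨ sum-map-mono starting-at (allFin n) ⟩
  ∑ {n} (λ a → if toℕ a <ᵇ m then 0 else (n ∸ suc (toℕ a)) C k)          ≡⟨ hockey-stick n m k ⟩
  (n ∸ m) C suc k                                                        ∎
  where
  open ℕ.≤-Reasoning
  tail-increasing : ∀ {a} {f : Fin k → Fin n} → IncreasingFrom m (a ∷ᵛ f) → IncreasingFrom (suc (toℕ a)) f
  tail-increasing (inc , _) = (λ s t s<t → inc (suc s) (suc t) (s≤s s<t)) , (λ t → inc zero (suc t) (s≤s z≤n))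
  starting-at : ∀ a → length (filter (increasingFrom? m ∘ (a ∷ᵛ_)) (allFuns k n))
                      ≤ (if toℕ a <ᵇ m then 0 else (n ∸ suc (toℕ a)) C k)
  starting-at a = by-cases (toℕ a <ᵇ m) refl
    where
    by-cases : ∀ b → (toℕ a <ᵇ m) ≡ b → length (filter (increasingFrom? m ∘ (a ∷ᵛ_)) (allFuns k n))
                                        ≤ (if b then 0 else (n ∸ suc (toℕ a)) C k)
    by-cases true  a<m = ℕ.≤-reflexive (length-filter-empty _
                           (λ f (_ , above) → ℕ.<⇒≱ (ℕ.<ᵇ⇒< (toℕ a) m (subst T (sym a<m) _)) (above zero)) (allFuns k n))
    by-cases false _   = ℕ.≤-trans (length-filter-mono _ (increasingFrom? (suc (toℕ a))) tail-increasing (allFuns k n))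
                                   (length-increasingFrom-≤ k n (suc (toℕ a)))

length-incTuples-≤ : ∀ k n → length (incTuples k n) ≤ n C k
length-incTuples-≤ k n = ℕ.≤-trans (length-filter-mono increasing? (increasingFrom? 0) (λ inc → inc , λ _ → z≤n) (allFuns k n))
                                   (length-increasingFrom-≤ k n 0)

pairProducts : ∀ {n} → (Fin n → ℕ) → ℕ
pairProducts {n} f = sum (map (λ p → f (proj₁ p) * f (proj₂ p)) (ltPairs n))

pairProducts≡∑∑ : ∀ {n} (f : Fin n → ℕ) → pairProducts f ≡ ∑ (λ c → ∑ (λ d → if does (c <ᶠ? d) then f c * f d else 0))
pairProducts≡∑∑ {n} f =
  trans (sum-map-filter (λ p → proj₁ p <ᶠ? proj₂ p) _ (cartesianProduct (allFin n) (allFin n)))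
        (sum-map-cartesianProduct _ (allFin n) (allFin n))

-- The terms with d = zero vanish by computation, and suc c <ᶠ? suc d reduces to c <ᶠ? d.
pairProducts-suc : ∀ {n} (f : Fin (suc n) → ℕ) → pairProducts f ≡ f zero * ∑ (f ∘ suc) + pairProducts (f ∘ suc)
pairProducts-suc {n} f = begin
  pairProducts f
    ≡⟨ pairProducts≡∑∑ f ⟩
  ∑ (λ c → ∑ (λ d → if does (c <ᶠ? d) then f c * f d else 0))
    ≡⟨ ∑-suc {n} (λ c → ∑ (λ d → if does (c <ᶠ? d) then f c * f d else 0)) ⟩
  ∑ (λ d → if does (zero {n} <ᶠ? d) then f zero * f d else 0) + ∑ (λ c → ∑ (λ d → if does (suc c <ᶠ? d) then f (suc c) * f d else 0))
    ≡⟨ cong₂ _+_ (trans (∑-suc {n} (λ d → if does (zero {n} <ᶠ? d) then f zero * f d else 0)) (sum-map-*ˡ (f zero) (f ∘ suc) (allFin n)))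
                 (cong sum (map-cong (λ c → ∑-suc {n} (λ d → if does (suc c <ᶠ? d) then f (suc c) * f d else 0)) (allFin n))) ⟩
  f zero * ∑ (f ∘ suc) + ∑ (λ c → ∑ (λ d → if does (c <ᶠ? d) then f (suc c) * f (suc d) else 0))
    ≡⟨ cong (f zero * ∑ (f ∘ suc) +_) (pairProducts≡∑∑ (f ∘ suc)) ⟨
  f zero * ∑ (f ∘ suc) + pairProducts (f ∘ suc) ∎
  where open ≡-Reasoning

square-∑ : ∀ {n} (f : Fin n → ℕ) → 2 * pairProducts f + ∑ (λ c → f c * f c) ≡ ∑ f * ∑ f
square-∑ {zero}  f = refl
square-∑ {suc n} f = begin
  2 * pairProducts f + ∑ (λ c → f c * f c)        ≡⟨ cong₂ (λ u v → 2 * u + v) (pairProducts-suc f) (∑-suc (λ c → f c * f c)) ⟩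
  2 * (a * s + pairProducts g) + (a * a + ∑ (λ c → g c * g c)) ≡⟨ regroup a s (pairProducts g) _ ⟩
  (2 * pairProducts g + ∑ (λ c → g c * g c)) + a * (2 * s + a) ≡⟨ cong (_+ a * (2 * s + a)) (square-∑ g) ⟩
  s * s + a * (2 * s + a)                           ≡⟨ complete-square a s ⟩
  (a + s) * (a + s)                                 ≡⟨ cong (λ t → t * t) (∑-suc f) ⟨
  ∑ f * ∑ f                                         ∎
  where
  open ≡-Reasoning
  g = f ∘ suc
  a = f zero
  s = ∑ g
  regroup : ∀ a s P Q → 2 * (a * s + P) + (a * a + Q) ≡ (2 * P + Q) + a * (2 * s + a)
  regroup = solve-∀
  complete-square : ∀ a s → s * s + a * (2 * s + a) ≡ (a + s) * (a + s)
  complete-square = solve-∀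

[2m+1]*x≤x*x+m*[m+1] : ∀ x m → (2 * m + 1) * x ≤ x * x + m * (m + 1)
[2m+1]*x≤x*x+m*[m+1] x m with x ℕ.≤? m
... | yes x≤m with d , refl ← ℕ.m≤n⇒∃[o]m+o≡n x≤m =
  subst ((2 * (x + d) + 1) * x ≤_) (below x d) (ℕ.m≤m+n _ (d * d + d))
  where
  below : ∀ x d → (2 * (x + d) + 1) * x + (d * d + d) ≡ x * x + (x + d) * (x + d + 1)
  below = solve-∀
... | no x≰m with e , refl ← ℕ.m≤n⇒∃[o]m+o≡n (ℕ.≰⇒> x≰m) =
  subst ((2 * m + 1) * (suc m + e) ≤_) (above m e) (ℕ.m≤m+n _ (e * e + e))
  where
  above : ∀ m e → (2 * m + 1) * (suc m + e) + (e * e + e) ≡ (suc m + e) * (suc m + e) + m * (m + 1)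
  above = solve-∀

∑-squares-≥ : ∀ {n} (f : Fin n → ℕ) m → (2 * m + 1) * ∑ f ≤ ∑ (λ c → f c * f c) + n * (m * (m + 1))
∑-squares-≥ {n} f m = begin
  (2 * m + 1) * ∑ f                               ≡⟨ sum-map-*ˡ (2 * m + 1) f (allFin n) ⟨
  ∑ (λ c → (2 * m + 1) * f c)                     ≤⟨ sum-map-mono (λ c → [2m+1]*x≤x*x+m*[m+1] (f c) m) (allFin n) ⟩
  ∑ (λ c → f c * f c + m * (m + 1))               ≡⟨ sum-map-+ (λ c → f c * f c) (λ _ → m * (m + 1)) (allFin n) ⟩
  ∑ (λ c → f c * f c) + ∑ {n} (λ _ → m * (m + 1)) ≡⟨ cong (∑ (λ c → f c * f c) +_) (∑-const n (m * (m + 1))) ⟩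
  ∑ (λ c → f c * f c) + n * (m * (m + 1))         ∎
  where open ℕ.≤-Reasoning

private
  M*M+r*s≤q*A : ∀ {q M A} r s m → r + s ≡ q → r + m * q ≡ M →
                (2 * m + 1) * M ≤ A + q * (m * (m + 1)) → M * M + r * s ≤ q * A
  M*M+r*s≤q*A {A = A} r s m refl refl lower = ℕ.+-cancelʳ-≤ (q * (q * (m * (m + 1)))) _ _ (begin
    M * M + r * s + q * (q * (m * (m + 1))) ≡⟨ expand r s m ⟩
    q * ((2 * m + 1) * M)                   ≤⟨ ℕ.*-monoʳ-≤ q lower ⟩
    q * (A + q * (m * (m + 1)))             ≡⟨ ℕ.*-distribˡ-+ q A _ ⟩
    q * A + q * (q * (m * (m + 1)))         ∎)
    where
    open ℕ.≤-Reasoning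
    q = r + s
    M = r + m * q
    expand : ∀ r s m → (r + m * (r + s)) * (r + m * (r + s)) + r * s + (r + s) * ((r + s) * (m * (m + 1)))
                     ≡ (r + s) * ((2 * m + 1) * (r + m * (r + s)))
    expand = solve-∀

∑-squares-balanced : ∀ {q M} .{{_ : ℕ.NonZero q}} (f : Fin q → ℕ) → ∑ f ≡ M →
  M * M + (M % q) * (q ∸ M % q) ≤ q * ∑ (λ c → f c * f c)
∑-squares-balanced {q} {M} f refl =
  M*M+r*s≤q*A (M % q) (q ∸ M % q) (M / q) (ℕ.m+[n∸m]≡n (ℕ.<⇒≤ (m%n<n M q))) (sym (m≡m%n+[m/n]*n M q)) (∑-squares-≥ f (M / q))

pairProducts-≤ : ∀ {q M} .{{_ : ℕ.NonZero q}} (f : Fin q → ℕ) → ∑ f ≡ M →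
  2 * q * pairProducts f + (M % q) * (q ∸ M % q) ≤ (q ∸ 1) * (M * M)
pairProducts-≤ {suc q′} {M} f ∑f≡M = ℕ.+-cancelʳ-≤ (M * M) _ _ (begin
  2 * q * P + r * s + M * M   ≡⟨ regroup (2 * q * P) (r * s) (M * M) ⟩
  2 * q * P + (M * M + r * s) ≤⟨ ℕ.+-monoʳ-≤ (2 * q * P) (∑-squares-balanced f ∑f≡M) ⟩
  2 * q * P + q * A           ≡⟨ factor q P A ⟩
  q * (2 * P + A)             ≡⟨ cong (q *_) (trans (square-∑ f) (cong₂ _*_ ∑f≡M ∑f≡M)) ⟩
  q * (M * M)                 ≡⟨ ℕ.+-comm (M * M) (q′ * (M * M)) ⟩
  q′ * (M * M) + M * M        ∎)
  where
  open ℕ.≤-Reasoning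
  q = suc q′
  r = M % q
  s = q ∸ r
  P = pairProducts f
  A = ∑ (λ c → f c * f c)
  regroup : ∀ a b c → a + b + c ≡ a + (c + b)
  regroup = solve-∀
  factor : ∀ q P A → 2 * q * P + q * A ≡ q * (2 * P + A)
  factor = solve-∀

toℚᵘ-/ : ∀ i d .{{_ : ℕ.NonZero d}} → ℚ.toℚᵘ (i ℚ./ d) ℚᵘ.≃ i ℚᵘ./ d
toℚᵘ-/ i (suc d) = ℚ.toℚᵘ-fromℚᵘ (i ℚᵘ./ suc d)

d*s≤l*[x+b]⇒s≤l*[x/d+b/d] : ∀ (s l x b : ℤ) d .{{_ : ℕ.NonZero d}} → ℤ.+ d ℤ.* s ℤ.≤ l ℤ.* (x ℤ.+ b) →
  s ℚ./ 1 ℚ.≤ (l ℚ./ 1) ℚ.* (x ℚ./ d ℚ.+ b ℚ./ d)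
d*s≤l*[x+b]⇒s≤l*[x/d+b/d] s l x b d@(suc _) d*s≤l*[x+b] =
  ℚ.toℚᵘ-cancel-≤ (ℚᵘ.≤-respˡ-≃ (ℚᵘ.≃-sym (toℚᵘ-/ s 1)) (ℚᵘ.≤-respʳ-≃ (ℚᵘ.≃-sym rhs≃) (ℚᵘ.*≤* cross-multiplied)))
  where
  rhs≃ : ℚ.toℚᵘ ((l ℚ./ 1) ℚ.* (x ℚ./ d ℚ.+ b ℚ./ d)) ℚᵘ.≃ (l ℚᵘ./ 1) ℚᵘ.* (x ℚᵘ./ d ℚᵘ.+ b ℚᵘ./ d)
  rhs≃ = ℚᵘ.≃-trans (ℚ.toℚᵘ-homo-* (l ℚ./ 1) _) (ℚᵘ.*-cong (toℚᵘ-/ l 1)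
           (ℚᵘ.≃-trans (ℚ.toℚᵘ-homo-+ (x ℚ./ d) _) (ℚᵘ.+-cong (toℚᵘ-/ x d) (toℚᵘ-/ b d))))
  cross-multiplied : s ℤ.* (ℤ.+ 1 ℤ.* (ℤ.+ d ℤ.* ℤ.+ d)) ℤ.≤ l ℤ.* (x ℤ.* ℤ.+ d ℤ.+ b ℤ.* ℤ.+ d) ℤ.* ℤ.+ 1
  cross-multiplied = subst₂ ℤ._≤_ (lhs s (ℤ.+ d)) (rhs l x b (ℤ.+ d)) (ℤ.*-monoʳ-≤-nonNeg (ℤ.+ d) d*s≤l*[x+b])
    where
    lhs : ∀ s D → D ℤ.* s ℤ.* D ≡ s ℤ.* (ℤ.+ 1 ℤ.* (D ℤ.* D))
    lhs = ℤ-Solver.solve-∀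
    rhs : ∀ l x b D → l ℤ.* (x ℤ.+ b) ℤ.* D ≡ l ℤ.* (x ℤ.* D ℤ.+ b ℤ.* D) ℤ.* ℤ.+ 1
    rhs = ℤ-Solver.solve-∀

+x+r*[r-q]≡+[x∸r*[q∸r]] : ∀ {x r q} → r ≤ q → r * (q ∸ r) ≤ x →
  ℤ.+ x ℤ.+ ℤ.+ r ℤ.* (ℤ.+ r ℤ.- ℤ.+ q) ≡ ℤ.+ (x ∸ r * (q ∸ r))
+x+r*[r-q]≡+[x∸r*[q∸r]] {r = r} {q} r≤q r*[q∸r]≤x with t , refl ← ℕ.m≤n⇒∃[o]m+o≡n r*[q∸r]≤x = begin
  ℤ.+ (r * s + t) ℤ.+ ℤ.+ r ℤ.* (ℤ.+ r ℤ.- ℤ.+ q)        ≡⟨ cong (λ q → ℤ.+ (r * s + t) ℤ.+ ℤ.+ r ℤ.* (ℤ.+ r ℤ.- ℤ.+ q)) (sym (ℕ.m+[n∸m]≡n r≤q)) ⟩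
  ℤ.+ (r * s + t) ℤ.+ ℤ.+ r ℤ.* (ℤ.+ r ℤ.- ℤ.+ (r + s))  ≡⟨ cong₂ (λ u v → u ℤ.+ ℤ.+ r ℤ.* (ℤ.+ r ℤ.- v)) (trans (ℤ.pos-+ (r * s) t) (cong (ℤ._+ ℤ.+ t) (ℤ.pos-* r s))) (ℤ.pos-+ r s) ⟩
  ℤ.+ r ℤ.* ℤ.+ s ℤ.+ ℤ.+ t ℤ.+ ℤ.+ r ℤ.* (ℤ.+ r ℤ.- (ℤ.+ r ℤ.+ ℤ.+ s)) ≡⟨ cancel (ℤ.+ r) (ℤ.+ s) (ℤ.+ t) ⟩
  ℤ.+ t                                                   ≡⟨ cong ℤ.+_ (ℕ.m+n∸m≡n (r * s) t) ⟨
  ℤ.+ (r * s + t ∸ r * s)                                 ∎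
  where
  open ≡-Reasoning
  s = q ∸ r
  cancel : ∀ r s t → r ℤ.* s ℤ.+ t ℤ.+ r ℤ.* (r ℤ.- (r ℤ.+ s)) ≡ t
  cancel = ℤ-Solver.solve-∀

module _ {c ℓ} (F : CommutativeRing c ℓ) {q′} (FF : IsFiniteField F (suc q′)) where
  open CommutativeRing F using (Carrier; _≈_; 0#) renaming (trans to ≈-trans; sym to ≈-sym)
  open IsFiniteField FF
  open Code F FF

  private
    q : ℕ
    q = suc q′

  ∑-x≡length : ∀ {M} (v : Fin M → Carrier) → ∑ (λ c → x c v) ≡ M
  ∑-x≡length {M} v = begin
    ∑ (λ c → x c v)                                        ≡⟨ cong sum (map-cong (λ c → length-filter≡sum (λ j → v j ≈? ω c) (allFin M)) (allFin q)) ⟩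
    ∑ (λ c → ∑ (λ j → if does (v j ≈? ω c) then 1 else 0)) ≡⟨ sum-map-swap (λ c j → if does (v j ≈? ω c) then 1 else 0) (allFin q) (allFin M) ⟩
    ∑ (λ j → ∑ (λ c → if does (v j ≈? ω c) then 1 else 0)) ≡⟨ cong sum (map-cong (λ j → ∑-indicator-unique (λ c → v j ≈? ω c) _ (≈-sym (proj₂ (ω-surj (v j)))) (ω-unique j)) (allFin M)) ⟩
    ∑ {M} (λ _ → 1)                                        ≡⟨ trans (∑-const M 1) (ℕ.*-identityʳ M) ⟩
    M                                                      ∎
    where
    open ≡-Reasoning
    ω-unique : ∀ j c → v j ≈ ω c → c ≡ proj₁ (ω-surj (v j))
    ω-unique j c vj≈ωc = ω-inj c _ (≈-trans (≈-sym vj≈ωc) (≈-sym (proj₂ (ω-surj (v j)))))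

  length-nonzeroTuples-≤ : ∀ k → length (nonzeroTuples k) ≤ q′ ^ k
  length-nonzeroTuples-≤ k = ℕ.≤-trans (ℕ.≤-reflexive (length-filter-map _ (λ f t → ω (f t)) (allFuns k q)))
                                      (length-avoiding-≤ (λ a → ω a ≈? 0#) (ω₁≈0 zero refl) k)

  S-≤ : ∀ {M n} (code : Fin M → Fin n → Carrier) k →
    2 * q * S code k ≤ (q′ ^ k * (n C k)) * (q′ * (M * M) ∸ (M % q) * (q ∸ M % q))
  S-≤ {M} {n} code k = begin
    2 * q * S code k                                        ≤⟨ *-sum-map-≤ (2 * q) _ _ per-α (nonzeroTuples k) ⟩
    length (nonzeroTuples k) * (length (incTuples k n) * D) ≤⟨ ℕ.*-mono-≤ (length-nonzeroTuples-≤ k) (ℕ.*-monoˡ-≤ D (length-incTuples-≤ k n)) ⟩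
    q′ ^ k * ((n C k) * D)                                  ≡⟨ ℕ.*-assoc (q′ ^ k) (n C k) D ⟨
    q′ ^ k * (n C k) * D                                    ∎
    where
    open ℕ.≤-Reasoning
    D = q′ * (M * M) ∸ (M % q) * (q ∸ M % q)
    per-α : ∀ α → 2 * q * sum (map (λ I → pairProducts (λ c → x c (combo code α I))) (incTuples k n)) ≤ length (incTuples k n) * D
    per-α α = *-sum-map-≤ (2 * q) D _ (λ I → ℕ.m+n≤o⇒m≤o∸n _ (pairProducts-≤ _ (∑-x≡length (combo code α I)))) (incTuples k n)

lemma2p3 : ∀ {c ℓ} (F : CommutativeRing c ℓ) (q : ℕ) (FF : IsFiniteField F q)
           (n M : ℕ) (code : Fin M → Fin n → CommutativeRing.Carrier F)
           → (∀ j j′ → (∀ i → CommutativeRing._≈_ F (code j i) (code j′ i)) → j ≡ j′)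
           → ∀ k → 1 ≤ k → k ≤ n
           → ((ℤ.+ Code.S F FF code k) ℚ./ 1) ℚ.≤ Code.bound F FF M n k
lemma2p3 F zero     FF n M code _ k _ _ with () ← proj₁ (IsFiniteField.ω-surj FF (CommutativeRing.0# F))
lemma2p3 F (suc q′) FF n M code _ k _ _ =
  d*s≤l*[x+b]⇒s≤l*[x/d+b/d] (ℤ.+ s) (ℤ.+ l) (ℤ.+ x) (ℤ.+ r ℤ.* (ℤ.+ r ℤ.- ℤ.+ q)) (2 * q) (begin
    ℤ.+ (2 * q) ℤ.* ℤ.+ s                               ≡⟨ ℤ.pos-* (2 * q) s ⟨
    ℤ.+ (2 * q * s)                                     ≤⟨ ℤ.+≤+ (S-≤ F FF code k) ⟩
    ℤ.+ (l * (x ∸ r * (q ∸ r)))                         ≡⟨ ℤ.pos-* l _ ⟩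
    ℤ.+ l ℤ.* ℤ.+ (x ∸ r * (q ∸ r))                     ≡⟨ cong (ℤ.+ l ℤ.*_) (+x+r*[r-q]≡+[x∸r*[q∸r]] r≤q r*[q∸r]≤x) ⟨
    ℤ.+ l ℤ.* (ℤ.+ x ℤ.+ ℤ.+ r ℤ.* (ℤ.+ r ℤ.- ℤ.+ q))   ∎)
  where
  open ℤ.≤-Reasoning
  q = suc q′
  s = Code.S F FF code k
  l = q′ ^ k * (n C k)
  x = q′ * (M * M)
  r = M % q
  r≤q : r ≤ q
  r≤q = ℕ.<⇒≤ (m%n<n M q)
  -- Any q counts summing to M witness this, e.g. those of the zero vector.
  r*[q∸r]≤x : r * (q ∸ r) ≤ x
  r*[q∸r]≤x = ℕ.≤-trans (ℕ.m≤n+m _ (2 * q * pairProducts counts)) (pairProducts-≤ counts (∑-x≡length F FF zeros))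
    where
    zeros : Fin M → CommutativeRing.Carrier F
    zeros _ = CommutativeRing.0# F
    counts : Fin q → ℕ
    counts c = Code.x F FF c zeros
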